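{- Let $I$ be an interval. Then inclusion is a total order on $\mathcal{B}_R(I)$ (for all $I',I''\in\mathcal{B}_R(I)$, $I'\subseteq I''$ or $I''\subseteq I'$), and for every MTL context $C$, all MTL formulae $\phi,\phi'$, and all $I',I''\in\mathcal{B}_R(I)$ with $I''\subseteq I'$, we have $C[\phi\,\mathcal{R}_{I'}\,\phi'] \sqsubseteq C[\phi\,\mathcal{R}_{I''}\,\phi']$.
   Context: An interval is $I=[a,b]$ with $a\in\mathbb{N}$, $b\in\mathbb{N}\cup\{\infty\}$, $a\le b$, viewed as a set of naturals. For $I=[a,b]$, $\mathcal{B}_R(I)$ (right-bound modifications of $I$) is the set of all intervals $[a,b+i]$ for $i\in\mathbb{N}$ together with all $[a,b-i]$ for $i\in\mathbb{N}$, $i\le b-a$ (with $\infty\pm i=\infty$). MTL formulae over propositions $\mathcal{P}$: $\phi ::= p \mid \top \mid \neg\phi \mid \phi\land\phi \mid \phi\,\mathcal{U}_I\,\phi \mid \phi\,\mathcal{R}_I\,\phi$, with $\phi_1\lor\phi_2:=\neg(\neg\phi_1\land\neg\phi_2)$. Traces $\pi$ are infinite sequences of subsets of $\mathcal{P}$; $\pi,t\vDash p$ iff $p\in\pi(t)$; $\neg,\land,\top$ as usual; $\pi,t\vDash\phi_1\,\mathcal{U}_I\,\phi_2$ iff there is $i\in I$ with $\pi,t+i\vDash\phi_2$ and $\pi,t+j\vDash\phi_1$ for all $j\in[0,i)\cap I$; $\pi,t\vDash\phi_1\,\mathcal{R}_I\,\phi_2$ iff either $\pi,t+i\vDash\phi_2$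 for all $i\in I$, or there is $j\in I$ with $\pi,t+j\vDash\phi_1$ and $\pi,t+i\vDash\phi_2$ for all $i\in[0,j]\cap I$ (equivalently $\neg(\neg\phi_1\,\mathcal{U}_I\,\neg\phi_2)$). $\phi\sqsubseteq\phi'$ iff for all traces $\pi$ and $t\in\mathbb{N}$, $\pi,t\vDash\phi$ implies $\pi,t\vDash\phi'$. MTL contexts: $C ::= [-] \mid C\land\phi \mid \phi\land C \mid C\lor\phi \mid \phi\lor C \mid C\,\mathcal{U}_I\,\phi \mid \phi\,\mathcal{U}_I\,C \mid C\,\mathcal{R}_I\,\phi \mid \phi\,\mathcal{R}_I\,C$ ($\phi$ an MTL formula, $I$ an interval); $C[\psi]$ is the formula obtained by replacing the unique hole $[-]$ by $\psi$. -}

module Defs where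

open import Data.Nat using (ℕ; _≤_; _<_; _+_; _∸_)
open import Data.Product using (Σ; _×_; ∃; _,_)
open import Data.Sum using (_⊎_)
open import Data.Empty using (⊥)
open import Data.Unit using (⊤)
open import Relation.Binary.PropositionalEquality using (_≡_)

data ℕ∞ : Set where
  fin : ℕ → ℕ∞
  ∞   : ℕ∞

_≤∞_ : ℕ → ℕ∞ → Set
n ≤∞ fin b = n ≤ b
n ≤∞ ∞     = ⊤

-- b + i and b - i with ∞ ± i = ∞ (∸ is truncated but only used with i ≤ b - a)
_+∞_ : ℕ∞ → ℕ → ℕ∞
fin b +∞ i = fin (b + i)
∞     +∞ i = ∞

_∸∞_ : ℕ∞ → ℕ → ℕ∞
fin b ∸∞ i = fin (b ∸ i)
∞     ∸∞ i = ∞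

record Interval : Set where
  constructor [_,_]⟨_⟩
  field
    lo : ℕ
    hi : ℕ∞
    lo≤hi : lo ≤∞ hi
open Interval public

_∈I_ : ℕ → Interval → Set
n ∈I I = lo I ≤ n × n ≤∞ hi I

_⊆I_ : Interval → Interval → Set
I ⊆I J = ∀ n → n ∈I I → n ∈I J

_∈𝓑R_ : Interval → Interval → Set
J ∈𝓑R I =
  lo J ≡ lo I ×
  ( (Σ ℕ λ i → hi J ≡ hi I +∞ i)
  ⊎ (Σ ℕ λ i → i ≤∞ (hi I ∸∞ lo I) × hi J ≡ hi I ∸∞ i))

data MTL (P : Set) : Set where
  atom : P → MTL P
  tt   : MTL P
  ¬ₘ_  : MTL P → MTL P
  _∧ₘ_ : MTL P → MTL P → MTL P
  _𝓤⟨_⟩_ : MTL P → Interval → MTL P → MTL P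
  _𝓡⟨_⟩_ : MTL P → Interval → MTL P → MTL P

_∨ₘ_ : {P : Set} → MTL P → MTL P → MTL P
φ₁ ∨ₘ φ₂ = ¬ₘ ((¬ₘ φ₁) ∧ₘ (¬ₘ φ₂))

-- traces: infinite sequences of subsets of P
Trace : Set → Set₁
Trace P = ℕ → P → Set

_,_⊨_ : {P : Set} → Trace P → ℕ → MTL P → Set
π , t ⊨ atom p = π t p
π , t ⊨ tt = ⊤
π , t ⊨ (¬ₘ φ) = π , t ⊨ φ → ⊥
π , t ⊨ (φ₁ ∧ₘ φ₂) = π , t ⊨ φ₁ × π , t ⊨ φ₂
π , t ⊨ (φ₁ 𝓤⟨ I ⟩ φ₂) =
  Σ ℕ λ i → i ∈I I × π , (t + i) ⊨ φ₂ ×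
    (∀ j → j ∈I I → j < i → π , (t + j) ⊨ φ₁)
π , t ⊨ (φ₁ 𝓡⟨ I ⟩ φ₂) =
  (∀ i → i ∈I I → π , (t + i) ⊨ φ₂)
  ⊎ (Σ ℕ λ j → j ∈I I × π , (t + j) ⊨ φ₁ ×
       (∀ i → i ∈I I → i ≤ j → π , (t + i) ⊨ φ₂))

_⊑_ : {P : Set} → MTL P → MTL P → Set₁
_⊑_ {P} φ φ' = (π : Trace P) (t : ℕ) → π , t ⊨ φ → π , t ⊨ φ'

data Ctx (P : Set) : Set where
  hole : Ctx P
  _∧ᶜˡ_ : Ctx P → MTL P → Ctx P
  _∧ᶜʳ_ : MTL P → Ctx P → Ctx P
  _∨ᶜˡ_ : Ctx P → MTL P → Ctx P
  _∨ᶜʳ_ : MTL P → Ctx P → Ctx P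
  _𝓤ᶜˡ⟨_⟩_ : Ctx P → Interval → MTL P → Ctx P
  _𝓤ᶜʳ⟨_⟩_ : MTL P → Interval → Ctx P → Ctx P
  _𝓡ᶜˡ⟨_⟩_ : Ctx P → Interval → MTL P → Ctx P
  _𝓡ᶜʳ⟨_⟩_ : MTL P → Interval → Ctx P → Ctx P

_[_] : {P : Set} → Ctx P → MTL P → MTL P
hole [ ψ ] = ψ
(C ∧ᶜˡ φ) [ ψ ] = (C [ ψ ]) ∧ₘ φ
(φ ∧ᶜʳ C) [ ψ ] = φ ∧ₘ (C [ ψ ])
(C ∨ᶜˡ φ) [ ψ ] = (C [ ψ ]) ∨ₘ φ
(φ ∨ᶜʳ C) [ ψ ] = φ ∨ₘ (C [ ψ ])
(C 𝓤ᶜˡ⟨ I ⟩ φ) [ ψ ] = (C [ ψ ]) 𝓤⟨ I ⟩ φ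
(φ 𝓤ᶜʳ⟨ I ⟩ C) [ ψ ] = φ 𝓤⟨ I ⟩ (C [ ψ ])
(C 𝓡ᶜˡ⟨ I ⟩ φ) [ ψ ] = (C [ ψ ]) 𝓡⟨ I ⟩ φ
(φ 𝓡ᶜʳ⟨ I ⟩ C) [ ψ ] = φ 𝓡⟨ I ⟩ (C [ ψ ])

{-# OPTIONS --safe #-}
-- All intervals of 𝓑_R(I) share the left end of I, so they are ordered by their right
-- ends. Shrinking the right end of a release interval weakens the release: the witness j
-- of φ either stays inside the smaller interval, or lies beyond it, and then φ′ holds on
-- all of it. Every context is monotone for ⊑, since the hole never occurs under
-- an odd number of negations (φ ∨ ψ abbreviates ¬(¬φ ∧ ¬ψ)).
module Submission where

open import Defs
open import Data.Product using (_×_; _,_)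
open import Data.Sum using (_⊎_; inj₁; inj₂)
open import Data.Nat using (_≤_; _≤?_)
open import Data.Nat.Properties using (≤-total; ≤-trans; <⇒≤; ≰⇒>)
open import Data.Unit using (tt)
open import Data.Empty using (⊥-elim)
open import Relation.Nullary using (¬_; Dec; yes; no)
open import Relation.Binary.PropositionalEquality using (_≡_; sym; trans; subst)

data _≤ℕ∞_ : ℕ∞ → ℕ∞ → Set where
  fin≤fin : ∀ {m n} → m ≤ n → fin m ≤ℕ∞ fin n
  x≤∞     : ∀ {x} → x ≤ℕ∞ ∞

≤ℕ∞-total : ∀ x y → x ≤ℕ∞ y ⊎ y ≤ℕ∞ x
≤ℕ∞-total (fin m) (fin n) with ≤-total m n
... | inj₁ m≤n = inj₁ (fin≤fin m≤n)
... | inj₂ n≤m = inj₂ (fin≤fin n≤m)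
≤ℕ∞-total x       ∞       = inj₁ x≤∞
≤ℕ∞-total ∞       (fin n) = inj₂ x≤∞

≤∞-trans : ∀ {n x y} → n ≤∞ x → x ≤ℕ∞ y → n ≤∞ y
≤∞-trans n≤m (fin≤fin m≤k) = ≤-trans n≤m m≤k
≤∞-trans _   x≤∞           = tt

_≤∞?_ : ∀ n x → Dec (n ≤∞ x)
n ≤∞? fin m = n ≤? m
n ≤∞? ∞     = yes tt

≤∞-≰∞⇒≤ : ∀ {i j} x → i ≤∞ x → ¬ (j ≤∞ x) → i ≤ j
≤∞-≰∞⇒≤ (fin m) i≤m j≰m = ≤-trans i≤m (<⇒≤ (≰⇒> j≰m))
≤∞-≰∞⇒≤ ∞       _   j≰∞ = ⊥-elim (j≰∞ tt)

⊆I-fromBounds : ∀ J K → lo J ≡ lo K → hi J ≤ℕ∞ hi K → J ⊆I K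
⊆I-fromBounds J K lo≡ hi≤ n (lo≤n , n≤hi) =
  subst (_≤ n) lo≡ lo≤n , ≤∞-trans n≤hi hi≤

⊆I-total-sameLo : ∀ J K → lo J ≡ lo K → J ⊆I K ⊎ K ⊆I J
⊆I-total-sameLo J K lo≡ with ≤ℕ∞-total (hi J) (hi K)
... | inj₁ J≤K = inj₁ (⊆I-fromBounds J K lo≡ J≤K)
... | inj₂ K≤J = inj₂ (⊆I-fromBounds K J (sym lo≡) K≤J)

𝓡-antitone-sameLo : ∀ {P} (φ φ′ : MTL P) I J → lo J ≡ lo I → J ⊆I I →
  (φ 𝓡⟨ I ⟩ φ′) ⊑ (φ 𝓡⟨ J ⟩ φ′)
𝓡-antitone-sameLo φ φ′ _ _ lo≡ J⊆I π t (inj₁ always) =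
  inj₁ λ i i∈J → always i (J⊆I i i∈J)
𝓡-antitone-sameLo φ φ′ _ J lo≡ J⊆I π t (inj₂ (j , (lo≤j , _) , φj , upto))
  with j ≤∞? hi J
... | yes j≤hi =
  inj₂ (j , (subst (_≤ j) (sym lo≡) lo≤j , j≤hi) , φj , λ i i∈J → upto i (J⊆I i i∈J))
... | no  j≰hi =
  inj₁ λ i i∈J@(_ , i≤hi) → upto i (J⊆I i i∈J) (≤∞-≰∞⇒≤ (hi J) i≤hi j≰hi)

module _ {P : Set} {ψ ψ′ : MTL P} (ψ⊑ψ′ : ψ ⊑ ψ′) where

  plug-monotone : (C : Ctx P) → (C [ ψ ]) ⊑ (C [ ψ′ ])
  plug-monotone hole = ψ⊑ψ′
  plug-monotone (C ∧ᶜˡ φ) π t (c , f) = plug-monotone C π t c , f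
  plug-monotone (φ ∧ᶜʳ C) π t (f , c) = f , plug-monotone C π t c
  plug-monotone (C ∨ᶜˡ φ) π t ¬¬∨ (¬c , ¬f) = ¬¬∨ ((λ c → ¬c (plug-monotone C π t c)) , ¬f)
  plug-monotone (φ ∨ᶜʳ C) π t ¬¬∨ (¬f , ¬c) = ¬¬∨ (¬f , (λ c → ¬c (plug-monotone C π t c)))
  plug-monotone (C 𝓤ᶜˡ⟨ I ⟩ φ) π t (i , i∈I , f , before) =
    i , i∈I , f , λ j j∈I j<i → plug-monotone C π _ (before j j∈I j<i)
  plug-monotone (φ 𝓤ᶜʳ⟨ I ⟩ C) π t (i , i∈I , c , before) =
    i , i∈I , plug-monotone C π _ c , before
  plug-monotone (C 𝓡ᶜˡ⟨ I ⟩ φ) π t (inj₁ always) = inj₁ always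
  plug-monotone (C 𝓡ᶜˡ⟨ I ⟩ φ) π t (inj₂ (j , j∈I , c , upto)) =
    inj₂ (j , j∈I , plug-monotone C π _ c , upto)
  plug-monotone (φ 𝓡ᶜʳ⟨ I ⟩ C) π t (inj₁ always) =
    inj₁ λ i i∈I → plug-monotone C π _ (always i i∈I)
  plug-monotone (φ 𝓡ᶜʳ⟨ I ⟩ C) π t (inj₂ (j , j∈I , f , upto)) =
    inj₂ (j , j∈I , f , λ i i∈I i≤j → plug-monotone C π _ (upto i i∈I i≤j))

lemma4 : {P : Set} (I : Interval) →
    ((I′ I″ : Interval) → I′ ∈𝓑R I → I″ ∈𝓑R I → (I′ ⊆I I″) ⊎ (I″ ⊆I I′))
    × ((C : Ctx P) (φ φ′ : MTL P) (I′ I″ : Interval) →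
         I′ ∈𝓑R I → I″ ∈𝓑R I → I″ ⊆I I′ →
         (C [ φ 𝓡⟨ I′ ⟩ φ′ ]) ⊑ (C [ φ 𝓡⟨ I″ ⟩ φ′ ]))
lemma4 I =
  (λ I′ I″ (lo′≡ , _) (lo″≡ , _) → ⊆I-total-sameLo I′ I″ (trans lo′≡ (sym lo″≡))) ,
  (λ C φ φ′ I′ I″ (lo′≡ , _) (lo″≡ , _) I″⊆I′ →
     plug-monotone (𝓡-antitone-sameLo φ φ′ I′ I″ (trans lo″≡ (sym lo′≡)) I″⊆I′) C)
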